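{- Let $q$ be a power of an odd prime $p$ and let $1\le n\le q^2-1$; write $n=u+vq$ with integers $0\le u,v\le q-1$. Define, in $\mathbb F_p$, \[ \mathrm{II}=\sum 2^{\alpha+\beta}\binom{2(q-1)-\alpha-\beta}{q-1}\binom{q-1-k}{j}(-1)^j, \] the sum being over all integers $\alpha,\beta,k,j$ with $\alpha,\beta\ge0$, $\beta\le q-2$, $0<\alpha+\beta\le q-1$, $k\ge1$, $j\ge0$, $k+j\le q-1$, $2k-j\equiv\alpha+\beta\pmod{q-1}$ and $q(q-1)+k-j-(\alpha+\beta q)=n$. Then, in $\mathbb F_p$, \[ \mathrm{II}=\sum_{\substack{s,\alpha\in\mathbb Z,\ 0\le s\le 2\\ \max\{0,\,v-s+\frac{u+v}{q-1}\}<\alpha\le \min\{q-1,\,v-s+\frac{u+v}{q-1}+1\}}}\binom{u+v-(s+\alpha-v-1)(q-1)}{(s+2\alpha-2v)(q-1)-2(u+v)}. \]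
   Context: For integers $m\ge0$ and $k$, $\binom mk$ is the usual binomial coefficient with $\binom mk=0$ if $k<0$ or $k>m$; integers, binomial coefficients and powers of $2$ are read modulo $p$. -}

module Defs where

open import Data.Nat as ℕ using (ℕ; zero; suc; _∸_)
import Data.Nat.Properties as ℕP
open import Data.Nat.Combinatorics using (_C_)
open import Data.Integer as ℤ using (ℤ; +_; -[1+_]; 0ℤ; 1ℤ; -1ℤ)
import Data.Integer.Properties as ℤP
open import Data.Integer.Divisibility.Signed using (_∣_; _∣?_)
open import Data.Rational.Unnormalised as Q using (ℚᵘ; mkℚᵘ; 0ℚᵘ; 1ℚᵘ)
import Data.Rational.Unnormalised.Properties as QP
open import Data.Product using (_×_)
open import Relation.Nullary using (Dec; yes; no)
open import Relation.Nullary.Decidable using (_×-dec_)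
open import Relation.Binary.PropositionalEquality using (_≡_)

sumTo : ℕ → (ℕ → ℤ) → ℤ
sumTo zero    f = 0ℤ
sumTo (suc N) f = sumTo N f ℤ.+ f N

when : {P : Set} → Dec P → ℤ → ℤ
when (yes _) x = x
when (no _)  _ = 0ℤ

-- The value for m < 0 is
-- never used in the statement (the summation range forces m ≥ 0); set to 0.
binomZ : ℤ → ℤ → ℤ
binomZ (+ m)    (+ k)    = + (m C k)
binomZ (+ m)    -[1+ _ ] = 0ℤ
binomZ -[1+ _ ] _        = 0ℤ

toQ : ℤ → ℚᵘ
toQ z = mkℚᵘ z 0

-- The sum II (as an integer; it is read modulo p in the statement).
-- Summation indices α, β, k, j range over naturals; the ranges
-- α < q, β < q-1, k < q, j < q contain all tuples allowed by the
-- conditions (α + β ≤ q-1, β ≤ q-2, k + j ≤ q-1), which are all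
-- repeated verbatim in condII.

condII : (q n α β k j : ℕ) → Set
condII q n α β k j =
  (β ℕ.≤ q ∸ 2) × (1 ℕ.≤ α ℕ.+ β) × (α ℕ.+ β ℕ.≤ q ∸ 1) ×
  (1 ℕ.≤ k) × (k ℕ.+ j ℕ.≤ q ∸ 1) ×
  ((+ (q ∸ 1)) ∣ ((+ (2 ℕ.* k) ℤ.- + j) ℤ.- + (α ℕ.+ β))) ×
  ((((+ (q ℕ.* (q ∸ 1)) ℤ.+ + k) ℤ.- + j) ℤ.- + (α ℕ.+ β ℕ.* q)) ≡ + n)

condII? : (q n α β k j : ℕ) → Dec (condII q n α β k j)
condII? q n α β k j =
  (β ℕ.≤? q ∸ 2) ×-dec (1 ℕ.≤? α ℕ.+ β) ×-dec (α ℕ.+ β ℕ.≤? q ∸ 1) ×-dec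
  (1 ℕ.≤? k) ×-dec (k ℕ.+ j ℕ.≤? q ∸ 1) ×-dec
  ((+ (q ∸ 1)) ∣? ((+ (2 ℕ.* k) ℤ.- + j) ℤ.- + (α ℕ.+ β))) ×-dec
  ((((+ (q ℕ.* (q ∸ 1)) ℤ.+ + k) ℤ.- + j) ℤ.- + (α ℕ.+ β ℕ.* q)) ℤP.≟ + n)

termII : (q α β k j : ℕ) → ℤ
termII q α β k j =
  + (2 ℕ.^ (α ℕ.+ β)) ℤ.* + ((2 ℕ.* (q ∸ 1) ∸ α ∸ β) C (q ∸ 1))
    ℤ.* + ((q ∸ 1 ∸ k) C j) ℤ.* (-1ℤ ℤ.^ j)

II : (q n : ℕ) → ℤ
II q n =
  sumTo q λ α → sumTo (q ∸ 1) λ β → sumTo q λ k → sumTo q λ j →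
    when (condII? q n α β k j) (termII q α β k j)

-- The right-hand side.
-- X s = v - s + (u+v)/(q-1) as a rational; (u+v)/(q-1) is written
-- mkℚᵘ (u+v) (q ∸ 2), i.e. numerator u+v over denominator suc (q ∸ 2) = q-1
-- (valid since q ≥ 3).

X : (q u v s : ℕ) → ℚᵘ
X q u v s = toQ (+ v ℤ.- + s) Q.+ mkℚᵘ (+ (u ℕ.+ v)) (q ∸ 2)

condR : (q u v s α : ℕ) → Set
condR q u v s α =
  ((0ℚᵘ Q.⊔ X q u v s) Q.< toQ (+ α)) ×
  (toQ (+ α) Q.≤ (toQ (+ (q ∸ 1)) Q.⊓ (X q u v s Q.+ 1ℚᵘ)))

condR? : (q u v s α : ℕ) → Dec (condR q u v s α)
condR? q u v s α =
  ((0ℚᵘ Q.⊔ X q u v s) QP.<? toQ (+ α)) ×-dec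
  (toQ (+ α) QP.≤? (toQ (+ (q ∸ 1)) Q.⊓ (X q u v s Q.+ 1ℚᵘ)))

termR : (q u v s α : ℕ) → ℤ
termR q u v s α =
  binomZ (+ (u ℕ.+ v) ℤ.- (((+ s ℤ.+ + α) ℤ.- + v) ℤ.- 1ℤ) ℤ.* + (q ∸ 1))
         ((((+ s ℤ.+ + (2 ℕ.* α)) ℤ.- + (2 ℕ.* v)) ℤ.* + (q ∸ 1)) ℤ.- + (2 ℕ.* (u ℕ.+ v)))

-- s ranges over 0..2; α over 0..q-1 (the condition forces 0 < α ≤ q-1)
RHS : (q u v : ℕ) → ℤ
RHS q u v =
  sumTo 3 λ s → sumTo q λ α → when (condR? q u v s α) (termR q u v s α)

module Submission where

-- Write Q = q - 1, which is even, and n = r + N Q with 0 ≤ r < Q.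
--
-- Modulo p the weight 2^(α+β) binom(2Q-α-β, Q) of II is the indicator of α + β = Q: for
-- 0 < m < q the identity (Q+1) binom(Q+m, Q+1) = m binom(Q+m, Q) shows p | binom(Q+m, Q), and
-- 2^Q ≡ 1 because 2^q = Σ binom(q, i) ≡ 2, every binom(q, i) with 0 < i < q being divisible by p.
--
-- For 1 ≤ α ≤ Q only β = Q - α contributes; the
-- congruence 2k - j ≡ α + β forces k + r ≡ 0 (mod Q), hence k = Q - r, and the linear condition
-- forces j = j₀(α) = (α + 1 - N) Q - 2r, which is even.  So the α-part of II is binom(r, j₀(α)).
-- On the right-hand side the bounds on α say exactly that α + s = N + 1, the two arguments of the
-- binomial coefficient then simplify to r and j₀(α), and when no s ∈ {0, 1, 2} fits, j₀(α) lies
-- outside [0, r].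

module FiniteSums where

  open import Defs using (sumTo; when)
  open import Data.Nat as ℕ using (ℕ; zero; suc; _<_)
  import Data.Nat.Properties as ℕP
  open import Data.Integer as ℤ using (ℤ; 0ℤ)
  import Data.Integer.Properties as ℤP
  open import Data.Integer.Divisibility.Signed using (_∣_; divides; ∣m∣n⇒∣m+n)
  open import Data.Integer.Tactic.RingSolver using (solve-∀)
  open import Data.Empty using (⊥-elim)
  open import Function using (_∘_; _⇔_; Equivalence)
  open Equivalence using (to; from)
  open import Relation.Nullary using (Dec; yes; no; ¬_)
  open import Relation.Binary.PropositionalEquality

  private
    below-suc : ∀ {N} {P : ℕ → Set} → (∀ i → i < suc N → P i) → ∀ i → i < N → P i
    below-suc h i i<N = h i (ℕP.m<n⇒m<1+n i<N)

  sumTo-cong : ∀ N {f g : ℕ → ℤ} → (∀ i → i < N → f i ≡ g i) → sumTo N f ≡ sumTo N g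
  sumTo-cong zero    f≡g = refl
  sumTo-cong (suc N) f≡g = cong₂ ℤ._+_ (sumTo-cong N (below-suc f≡g)) (f≡g N (ℕP.n<1+n N))

  sumTo-zero : ∀ N {f : ℕ → ℤ} → (∀ i → i < N → f i ≡ 0ℤ) → sumTo N f ≡ 0ℤ
  sumTo-zero zero    f≡0 = refl
  sumTo-zero (suc N) f≡0
    rewrite sumTo-zero N (below-suc f≡0) | f≡0 N (ℕP.n<1+n N) = refl

  sumTo-single : ∀ N {f : ℕ → ℤ} i₀ → i₀ < N → (∀ i → i < N → i ≢ i₀ → f i ≡ 0ℤ) →
                 sumTo N f ≡ f i₀
  sumTo-single (suc N) {f} i₀ i₀<1+N f≡0 with i₀ ℕ.≟ N
  ... | yes refl
    rewrite sumTo-zero N (λ i i<N → f≡0 i (ℕP.m<n⇒m<1+n i<N) (ℕP.<⇒≢ i<N))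
    = ℤP.+-identityˡ (f i₀)
  ... | no i₀≢N
    rewrite sumTo-single N i₀ (ℕP.≤∧≢⇒< (ℕP.≤-pred i₀<1+N) i₀≢N) (below-suc f≡0)
          | f≡0 N (ℕP.n<1+n N) (i₀≢N ∘ sym) = ℤP.+-identityʳ (f i₀)

  sumTo-distrib-+ : ∀ N (f g : ℕ → ℤ) →
                    sumTo N (λ i → f i ℤ.+ g i) ≡ sumTo N f ℤ.+ sumTo N g
  sumTo-distrib-+ zero    f g = refl
  sumTo-distrib-+ (suc N) f g rewrite sumTo-distrib-+ N f g =
    interchange (sumTo N f) (sumTo N g) (f N) (g N)
    where
    interchange : ∀ a b c d → (a ℤ.+ b) ℤ.+ (c ℤ.+ d) ≡ (a ℤ.+ c) ℤ.+ (b ℤ.+ d)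
    interchange = solve-∀

  sumTo-comm : ∀ M N (h : ℕ → ℕ → ℤ) →
               sumTo M (λ s → sumTo N (h s)) ≡ sumTo N (λ a → sumTo M (λ s → h s a))
  sumTo-comm zero    N h = sym (sumTo-zero N (λ _ _ → refl))
  sumTo-comm (suc M) N h rewrite sumTo-comm M N h =
    sym (sumTo-distrib-+ N (λ a → sumTo M (λ s → h s a)) (h M))

  sumTo-∣-cong : ∀ N {k} {f g : ℕ → ℤ} → (∀ i → i < N → k ∣ (f i ℤ.- g i)) →
                 k ∣ (sumTo N f ℤ.- sumTo N g)
  sumTo-∣-cong zero    _ = divides 0ℤ refl
  sumTo-∣-cong (suc N) {k} {f} {g} f≡g =
    subst (k ∣_) (interchange (sumTo N f) (sumTo N g) (f N) (g N))
      (∣m∣n⇒∣m+n (sumTo-∣-cong N (below-suc f≡g)) (f≡g N (ℕP.n<1+n N)))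
    where
    interchange : ∀ a b c d → (a ℤ.- b) ℤ.+ (c ℤ.- d) ≡ (a ℤ.+ c) ℤ.- (b ℤ.+ d)
    interchange = solve-∀

  when-yes : ∀ {P : Set} (d : Dec P) {x} → P → when d x ≡ x
  when-yes (yes _) _ = refl
  when-yes (no ¬p) p = ⊥-elim (¬p p)

  when-no : ∀ {P : Set} (d : Dec P) {x} → ¬ P → when d x ≡ 0ℤ
  when-no (yes p) ¬p = ⊥-elim (¬p p)
  when-no (no _)  _  = refl

  when-0ℤ : ∀ {P : Set} (d : Dec P) → when d 0ℤ ≡ 0ℤ
  when-0ℤ (yes _) = refl
  when-0ℤ (no _)  = refl

  when-cong : ∀ {P P′ : Set} (d : Dec P) (d′ : Dec P′) {x y} →
              P ⇔ P′ → (P → x ≡ y) → when d x ≡ when d′ y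
  when-cong (yes p) (yes _)  _    x≡y = x≡y p
  when-cong (yes p) (no ¬p′) P⇔P′ _   = ⊥-elim (¬p′ (to P⇔P′ p))
  when-cong (no ¬p) (yes p′) P⇔P′ _   = ⊥-elim (¬p (from P⇔P′ p′))
  when-cong (no _)  (no _)   _    _   = refl

module Binomials where

  open import Data.Nat
  open import Data.Nat.Properties
  open import Data.Nat.Combinatorics
  open import Data.Nat.Divisibility
  open import Data.Nat.Primality
  open import Data.Nat.DivMod using (m/n*n≡m)
  open import Data.Sum using (inj₁; inj₂)
  open import Relation.Binary.PropositionalEquality
  import Data.Nat.Tactic.RingSolver as ℕ-Solver

  private
    variable
      p n Q : ℕ

  nCk*k!*[n∸k]!≡n! : ∀ {n k} → k ≤ n → (n C k) * (k ! * (n ∸ k) !) ≡ n !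
  nCk*k!*[n∸k]!≡n! {n} {k} k≤n =
    trans (cong (_* (k ! * (n ∸ k) !)) (nCk≡n!/k![n-k]! k≤n)) (m/n*n≡m (k![n∸k]!∣n! k≤n))
    where instance _ = k !* (n ∸ k) !≢0

  private
    regroup : ∀ a b c x → (a * x) * (b * c) ≡ x * ((a * b) * c)
    regroup = ℕ-Solver.solve-∀
    regroup′ : ∀ x a b c → x * (a * (b * c)) ≡ (b * x) * (a * c)
    regroup′ = ℕ-Solver.solve-∀

  [1+k]*nC[1+k]≡[n∸k]*nCk : ∀ {n k} → k < n → suc k * (n C suc k) ≡ (n ∸ k) * (n C k)
  [1+k]*nC[1+k]≡[n∸k]*nCk {n} {k} k<n = *-cancelʳ-≡ _ _ (k ! * (n ∸ suc k) !) (begin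
      (suc k * (n C suc k)) * (k ! * (n ∸ suc k) !)
        ≡⟨ regroup (suc k) (k !) ((n ∸ suc k) !) (n C suc k) ⟩
      (n C suc k) * (suc k ! * (n ∸ suc k) !)
        ≡⟨ nCk*k!*[n∸k]!≡n! k<n ⟩
      n !
        ≡⟨ nCk*k!*[n∸k]!≡n! (<⇒≤ k<n) ⟨
      (n C k) * (k ! * (n ∸ k) !)
        ≡⟨ cong (λ m → (n C k) * (k ! * m)) ([n-k]*[n-k-1]!≡[n-k]! k<n) ⟨
      (n C k) * (k ! * ((n ∸ k) * (n ∸ suc k) !))
        ≡⟨ regroup′ (n C k) (k !) (n ∸ k) ((n ∸ suc k) !) ⟩
      ((n ∸ k) * (n C k)) * (k ! * (n ∸ suc k) !) ∎)
    where
    open ≡-Reasoning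
    instance _ = k !* (n ∸ suc k) !≢0

  [1+k]*[1+n]C[1+k]≡[1+n]*nCk : ∀ {n k} → k ≤ n → suc k * (suc n C suc k) ≡ suc n * (n C k)
  [1+k]*[1+n]C[1+k]≡[1+n]*nCk {n} {k} k≤n = *-cancelʳ-≡ _ _ (k ! * (n ∸ k) !) (begin
      (suc k * (suc n C suc k)) * (k ! * (n ∸ k) !)
        ≡⟨ regroup (suc k) (k !) ((n ∸ k) !) (suc n C suc k) ⟩
      (suc n C suc k) * (suc k ! * (suc n ∸ suc k) !)
        ≡⟨ nCk*k!*[n∸k]!≡n! (s≤s k≤n) ⟩
      suc n * n !
        ≡⟨ cong (suc n *_) (nCk*k!*[n∸k]!≡n! k≤n) ⟨
      suc n * ((n C k) * (k ! * (n ∸ k) !))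
        ≡⟨ *-assoc (suc n) (n C k) _ ⟨
      (suc n * (n C k)) * (k ! * (n ∸ k) !) ∎)
    where
    open ≡-Reasoning
    instance _ = k !* (n ∸ k) !≢0

  p^e∣m*x⇒p∣x : Prime p → ∀ e {m x} → 0 < m → m < p ^ e → p ^ e ∣ m * x → p ∣ x
  p^e∣m*x⇒p∣x pr zero (s≤s z≤n) (s≤s ())
  p^e∣m*x⇒p∣x {p} pr (suc e) {m} {x} 0<m m<p^[1+e] p^[1+e]∣m*x
    with euclidsLemma m x pr (∣-trans (m∣m*n (p ^ e)) p^[1+e]∣m*x)
  ... | inj₂ p∣x = p∣x
  ... | inj₁ (divides m′ refl) = p^e∣m*x⇒p∣x pr e 0<m′ m′<p^e p^e∣m′*x
    where
    instance _ = prime⇒nonZero pr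
    0<m′ : 0 < m′
    0<m′ = n≢0⇒n>0 (λ m′≡0 → <-irrefl (sym (cong (_* p) m′≡0)) 0<m)
    m′<p^e : m′ < p ^ e
    m′<p^e = *-cancelʳ-< p m′ (p ^ e) (subst (m′ * p <_) (*-comm p (p ^ e)) m<p^[1+e])
    p^e∣m′*x : p ^ e ∣ m′ * x
    p^e∣m′*x = *-cancelˡ-∣ p (subst (p * p ^ e ∣_) (swap m′ p x) p^[1+e]∣m*x)
      where
      swap : ∀ a b c → (a * b) * c ≡ b * (a * c)
      swap = ℕ-Solver.solve-∀

  p∣[1+n]C[1+k] : Prime p → ∀ e → suc n ≡ p ^ e → ∀ {k} → k < n → p ∣ suc n C suc k
  p∣[1+n]C[1+k] {p} {n} pr e q≡p^e {k} k<n =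
    p^e∣m*x⇒p∣x pr e (s≤s z≤n) (subst (suc k <_) q≡p^e (s≤s k<n))
      (divides (n C k) (begin
        suc k * (suc n C suc k) ≡⟨ [1+k]*[1+n]C[1+k]≡[1+n]*nCk (<⇒≤ k<n) ⟩
        suc n * (n C k)         ≡⟨ *-comm (suc n) (n C k) ⟩
        (n C k) * suc n         ≡⟨ cong ((n C k) *_) q≡p^e ⟩
        (n C k) * p ^ e         ∎))
    where open ≡-Reasoning

  p∣[Q+m]CQ : Prime p → ∀ e → suc Q ≡ p ^ e → ∀ {m} → 0 < m → m < p ^ e → p ∣ (Q + m) C Q
  p∣[Q+m]CQ {p} {Q} pr e q≡p^e {m} 0<m m<p^e =
    p^e∣m*x⇒p∣x pr e 0<m m<p^e (divides ((Q + m) C suc Q) (begin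
      m * ((Q + m) C Q)           ≡⟨ cong (_* ((Q + m) C Q)) (m+n∸m≡n Q m) ⟨
      (Q + m ∸ Q) * ((Q + m) C Q) ≡⟨ [1+k]*nC[1+k]≡[n∸k]*nCk (m<m+n Q 0<m) ⟨
      suc Q * ((Q + m) C suc Q)   ≡⟨ *-comm (suc Q) _ ⟩
      ((Q + m) C suc Q) * suc Q   ≡⟨ cong (((Q + m) C suc Q) *_) q≡p^e ⟩
      ((Q + m) C suc Q) * p ^ e   ∎))
    where open ≡-Reasoning

module PowersOfTwo where

  open FiniteSums
  open Binomials
  open import Defs using (sumTo)
  open import Data.Nat as ℕ using (ℕ; zero; suc; _^_; _≤_; nonTrivial⇒n>1)
  import Data.Nat.Properties as ℕP
  open import Data.Nat.Combinatorics using (_C_; nCn≡1; nCk+nC[k+1]≡[n+1]C[k+1]; k>n⇒nCk≡0)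
  import Data.Nat.Divisibility as ℕ
  open import Data.Nat.Primality using (Prime; euclidsLemma; prime⇒nonTrivial)
  open import Data.Integer as ℤ using (ℤ; +_; 0ℤ; 1ℤ)
  import Data.Integer.Properties as ℤP
  open import Data.Integer.Divisibility.Signed using (_∣_; divides; ∣m∣n⇒∣m+n; ∣⇒∣ᵤ; ∣ᵤ⇒∣)
  open import Data.Integer.Tactic.RingSolver using (solve-∀)
  open import Data.Sum using (inj₁; inj₂)
  open import Relation.Nullary using (¬_)
  open import Data.Empty using (⊥-elim)
  open import Relation.Binary.PropositionalEquality

  private
    variable
      p n : ℕ

  rowSum : ℕ → ℕ → ℤ
  rowSum n N = sumTo N (λ i → + (n C i))

  rowSum-pascal : ∀ n N → rowSum (suc n) (suc N) ≡ rowSum n (suc N) ℤ.+ rowSum n N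
  rowSum-pascal n zero    = refl
  rowSum-pascal n (suc N) = begin
      rowSum (suc n) (suc N) ℤ.+ + (suc n C suc N)
        ≡⟨ cong₂ ℤ._+_ (rowSum-pascal n N) (cong +_ (sym (nCk+nC[k+1]≡[n+1]C[k+1] n N))) ⟩
      (rowSum n (suc N) ℤ.+ rowSum n N) ℤ.+ (+ (n C N) ℤ.+ + (n C suc N))
        ≡⟨ shuffle (rowSum n (suc N)) (rowSum n N) (+ (n C N)) (+ (n C suc N)) ⟩
      (rowSum n (suc N) ℤ.+ + (n C suc N)) ℤ.+ (rowSum n N ℤ.+ + (n C N)) ∎
    where
    open ≡-Reasoning
    shuffle : ∀ a b c d → (a ℤ.+ b) ℤ.+ (c ℤ.+ d) ≡ (a ℤ.+ d) ℤ.+ (b ℤ.+ c)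
    shuffle = solve-∀

  rowSum≡2^ : ∀ n → rowSum n (suc n) ≡ + (2 ^ n)
  rowSum≡2^ zero    = refl
  rowSum≡2^ (suc n) = begin
      rowSum (suc n) (suc (suc n))
        ≡⟨ rowSum-pascal n (suc n) ⟩
      rowSum n (suc (suc n)) ℤ.+ rowSum n (suc n)
        ≡⟨ cong (λ c → (rowSum n (suc n) ℤ.+ + c) ℤ.+ rowSum n (suc n)) (k>n⇒nCk≡0 (ℕP.n<1+n n)) ⟩
      (rowSum n (suc n) ℤ.+ 0ℤ) ℤ.+ rowSum n (suc n)
        ≡⟨ cong (λ x → (x ℤ.+ 0ℤ) ℤ.+ x) (rowSum≡2^ n) ⟩
      (+ (2 ^ n) ℤ.+ 0ℤ) ℤ.+ + (2 ^ n)
        ≡⟨ double (+ (2 ^ n)) ⟩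
      + 2 ℤ.* + (2 ^ n)
        ≡⟨ ℤP.pos-* 2 (2 ^ n) ⟨
      + (2 ^ suc n) ∎
    where
    open ≡-Reasoning
    double : ∀ x → (x ℤ.+ 0ℤ) ℤ.+ x ≡ + 2 ℤ.* x
    double = solve-∀

  p∣rowSum-1 : Prime p → ∀ e → suc n ≡ p ^ e → ∀ N → N ≤ n →
               + p ∣ rowSum (suc n) (suc N) ℤ.- 1ℤ
  p∣rowSum-1 pr e q≡p^e zero    _   = divides 0ℤ refl
  p∣rowSum-1 {p} {n} pr e q≡p^e (suc N) N<n =
    subst (+ p ∣_) (shift (rowSum (suc n) (suc N)) (+ (suc n C suc N)))
      (∣m∣n⇒∣m+n (p∣rowSum-1 pr e q≡p^e N (ℕP.<⇒≤ N<n))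
                 (∣ᵤ⇒∣ (p∣[1+n]C[1+k] pr e q≡p^e N<n)))
    where
    shift : ∀ a b → (a ℤ.- 1ℤ) ℤ.+ b ≡ (a ℤ.+ b) ℤ.- 1ℤ
    shift = solve-∀

  p∣2^q-2 : Prime p → ∀ e → suc n ≡ p ^ e → + p ∣ + (2 ^ suc n) ℤ.- + 2
  p∣2^q-2 {p} {n} pr e q≡p^e =
    subst (+ p ∣_) rowSum-1≡2^q-2 (p∣rowSum-1 pr e q≡p^e n ℕP.≤-refl)
    where
    shift : ∀ a → a ℤ.- 1ℤ ≡ (a ℤ.+ 1ℤ) ℤ.- + 2
    shift = solve-∀
    rowSum-1≡2^q-2 : rowSum (suc n) (suc n) ℤ.- 1ℤ ≡ + (2 ^ suc n) ℤ.- + 2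
    rowSum-1≡2^q-2 = trans (shift (rowSum (suc n) (suc n)))
      (cong (ℤ._- + 2) (trans (cong (λ c → rowSum (suc n) (suc n) ℤ.+ + c) (sym (nCn≡1 (suc n))))
                              (rowSum≡2^ (suc n))))

  p∣a*x⇒p∣x : Prime p → ∀ {a x} → ¬ p ℕ.∣ a → + p ∣ + a ℤ.* x → + p ∣ x
  p∣a*x⇒p∣x {p} pr {a} {x} p∤a p∣a*x
    with euclidsLemma a ℤ.∣ x ∣ pr (subst (p ℕ.∣_) (ℤP.abs-* (+ a) x) (∣⇒∣ᵤ p∣a*x))
  ... | inj₁ p∣a   = ⊥-elim (p∤a p∣a)
  ... | inj₂ p∣∣x∣ = ∣ᵤ⇒∣ p∣∣x∣

  p∣2^[q-1]-1 : Prime p → p ≢ 2 → ∀ e → suc n ≡ p ^ e → + p ∣ + (2 ^ n) ℤ.- 1ℤ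
  p∣2^[q-1]-1 {p} {n} pr p≢2 e q≡p^e =
    p∣a*x⇒p∣x pr p∤2 (subst (+ p ∣_) 2^q-2≡2*[2^[q-1]-1] (p∣2^q-2 pr e q≡p^e))
    where
    p∤2 : ¬ p ℕ.∣ 2
    p∤2 p∣2 = p≢2 (ℕP.≤-antisym (ℕ.∣⇒≤ p∣2) (ℕ.nonTrivial⇒n>1 p {{prime⇒nonTrivial pr}}))
    factor : ∀ a → + 2 ℤ.* a ℤ.- + 2 ≡ + 2 ℤ.* (a ℤ.- 1ℤ)
    factor = solve-∀
    2^q-2≡2*[2^[q-1]-1] : + (2 ^ suc n) ℤ.- + 2 ≡ + 2 ℤ.* (+ (2 ^ n) ℤ.- 1ℤ)
    2^q-2≡2*[2^[q-1]-1] = trans (cong (ℤ._- + 2) (ℤP.pos-* 2 (2 ^ n))) (factor (+ (2 ^ n)))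

module Reduction where

  open FiniteSums
  open Binomials
  open PowersOfTwo
  open import Defs
  open import Data.Nat as ℕ using (ℕ; suc; _^_; _≤_; _<_; _∸_)
  import Data.Nat.Properties as ℕP
  import Data.Nat.Divisibility as ℕ
  open import Data.Nat.Combinatorics using (_C_; nCn≡1)
  open import Data.Nat.Primality using (Prime)
  open import Data.Integer as ℤ using (ℤ; +_; 0ℤ; 1ℤ; -1ℤ)
  import Data.Integer.Properties as ℤP
  open import Data.Integer.Divisibility.Signed using (_∣_; divides; ∣m⇒∣m*n; ∣n⇒∣m*n; ∣ᵤ⇒∣)
  open import Data.Integer.Tactic.RingSolver using (solve-∀)
  open import Data.Product using (_,_)
  open import Relation.Nullary using (Dec; yes; no)
  open import Relation.Binary.PropositionalEquality

  private
    variable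
      p : ℕ

  -- II with its weight 2^(α+β) (2(q-1)-α-β choose q-1) replaced by the residue [α+β = q-1] mod p.
  termII′ : (q α β k j : ℕ) → ℤ
  termII′ q α β k j = when (α ℕ.+ β ℕ.≟ q ∸ 1) (+ ((q ∸ 1 ∸ k) C j) ℤ.* (-1ℤ ℤ.^ j))

  II′ : (q n : ℕ) → ℤ
  II′ q n =
    sumTo q λ α → sumTo (q ∸ 1) λ β → sumTo q λ k → sumTo q λ j →
      when (condII? q n α β k j) (termII′ q α β k j)

  p∣weight-residue : Prime p → p ≢ 2 → ∀ e {Q} → suc Q ≡ p ^ e → ∀ {c} → 1 ≤ c → c ≤ Q → ∀ x →
    + p ∣ + (2 ^ c) ℤ.* + ((2 ℕ.* Q ∸ c) C Q) ℤ.* x ℤ.- when (c ℕ.≟ Q) x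
  p∣weight-residue {p} pr p≢2 e {Q} q≡p^e {c} 1≤c c≤Q x with c ℕ.≟ Q
  ... | yes refl = subst (+ p ∣_) (sym residue) (∣m⇒∣m*n x (p∣2^[q-1]-1 pr p≢2 e q≡p^e))
    where
    2Q∸Q≡Q : 2 ℕ.* Q ∸ Q ≡ Q
    2Q∸Q≡Q = trans (cong (λ m → Q ℕ.+ m ∸ Q) (ℕP.+-identityʳ Q)) (ℕP.m+n∸m≡n Q Q)
    factor : ∀ a x → a ℤ.* 1ℤ ℤ.* x ℤ.- x ≡ (a ℤ.- 1ℤ) ℤ.* x
    factor = solve-∀
    residue : + (2 ^ Q) ℤ.* + ((2 ℕ.* Q ∸ Q) C Q) ℤ.* x ℤ.- x ≡ (+ (2 ^ Q) ℤ.- 1ℤ) ℤ.* x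
    residue rewrite 2Q∸Q≡Q | nCn≡1 Q = factor (+ (2 ^ Q)) x
  ... | no c≢Q = subst (+ p ∣_) (sym (ℤP.+-identityʳ _))
                   (∣m⇒∣m*n x (∣n⇒∣m*n (+ (2 ^ c)) (∣ᵤ⇒∣ p∣C)))
    where
    c<Q = ℕP.≤∧≢⇒< c≤Q c≢Q
    m = Q ∸ c
    2Q∸c≡Q+m : 2 ℕ.* Q ∸ c ≡ Q ℕ.+ m
    2Q∸c≡Q+m = trans (cong (λ n → Q ℕ.+ n ∸ c) (ℕP.+-identityʳ Q)) (ℕP.+-∸-assoc Q c≤Q)
    p∣C : p ℕ.∣ (2 ℕ.* Q ∸ c) C Q
    p∣C = subst (λ n → p ℕ.∣ n C Q) (sym 2Q∸c≡Q+m)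
            (p∣[Q+m]CQ pr e q≡p^e (ℕP.m<n⇒0<n∸m c<Q)
               (subst (m <_) q≡p^e (ℕP.m<n⇒m<1+n (ℕP.∸-monoʳ-< {Q} {c} {0} 1≤c c≤Q))))

  p∣II-II′ : Prime p → p ≢ 2 → ∀ e {Q} → suc Q ≡ p ^ e → ∀ n → + p ∣ II (suc Q) n ℤ.- II′ (suc Q) n
  p∣II-II′ {p} pr p≢2 e {Q} q≡p^e n =
    sumTo-∣-cong (suc Q) λ α _ → sumTo-∣-cong Q λ β _ →
    sumTo-∣-cong (suc Q) λ k _ → sumTo-∣-cong (suc Q) λ j _ →
      termwise α β k j (condII? (suc Q) n α β k j)
    where
    termwise : ∀ α β k j (d : Dec (condII (suc Q) n α β k j)) →
      + p ∣ when d (termII (suc Q) α β k j) ℤ.- when d (termII′ (suc Q) α β k j)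
    termwise α β k j (no _) = divides 0ℤ refl
    termwise α β k j (yes (_ , 1≤α+β , α+β≤Q , _)) =
      subst (λ t → + p ∣ t ℤ.- termII′ (suc Q) α β k j) (sym regroup)
        (p∣weight-residue pr p≢2 e q≡p^e 1≤α+β α+β≤Q (+ ((Q ∸ k) C j) ℤ.* (-1ℤ ℤ.^ j)))
      where
      regroup : termII (suc Q) α β k j ≡
        + (2 ^ (α ℕ.+ β)) ℤ.* + ((2 ℕ.* Q ∸ (α ℕ.+ β)) C Q) ℤ.* (+ ((Q ∸ k) C j) ℤ.* (-1ℤ ℤ.^ j))
      regroup rewrite ℕP.∸-+-assoc (2 ℕ.* Q) α β =
        ℤP.*-assoc (+ (2 ^ (α ℕ.+ β)) ℤ.* + ((2 ℕ.* Q ∸ (α ℕ.+ β)) C Q)) (+ ((Q ∸ k) C j)) (-1ℤ ℤ.^ j)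

module Indicators where

  open FiniteSums
  open import Defs using (sumTo; when; binomZ)
  open import Data.Nat as ℕ using (_≤_; _<_; _∸_)
  import Data.Nat.Properties as ℕP
  open import Data.Nat.Combinatorics using (_C_; k>n⇒nCk≡0)
  open import Data.Integer as ℤ using (+_; -[1+_])
  import Data.Integer.Properties as ℤP
  open import Data.Product using (_×_)
  open import Function using (_∘_)
  open import Relation.Nullary using (yes; no)
  open import Relation.Nullary.Decidable using (_×-dec_)
  open import Relation.Binary.PropositionalEquality

  Σ-when≡binomZ : ∀ r M z → r < M →
                  sumTo M (λ j → when (+ j ℤ.≟ z) (+ (r C j))) ≡ binomZ (+ r) z
  Σ-when≡binomZ r M -[1+ m ] _ = sumTo-zero M (λ j _ → when-no (+ j ℤ.≟ -[1+ m ]) {+ (r C j)} λ ())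
  Σ-when≡binomZ r M (+ J) r<M with J ℕ.<? M
  ... | yes J<M = trans
    (sumTo-single M J J<M (λ j _ j≢J → when-no (+ j ℤ.≟ + J) (j≢J ∘ ℤP.+-injective)))
    (when-yes (+ J ℤ.≟ + J) refl)
  ... | no J≮M = trans
    (sumTo-zero M (λ j j<M → when-no (+ j ℤ.≟ + J)
      (λ j≡J → J≮M (subst (_< M) (ℤP.+-injective j≡J) j<M))))
    (cong +_ (sym (k>n⇒nCk≡0 (ℕP.<-≤-trans r<M (ℕP.≮⇒≥ J≮M)))))

  Σ-when-shift : ∀ S α M b →
    sumTo S (λ s → when (α ℕ.+ s ℕ.≟ M) b) ≡ when ((α ℕ.≤? M) ×-dec (M ℕ.<? α ℕ.+ S)) b
  Σ-when-shift S α M b with α ℕ.≤? M | M ℕ.<? α ℕ.+ S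
  ... | yes α≤M | yes M<α+S = trans
    (sumTo-single S (M ∸ α) M∸α<S (λ s _ s≢M∸α → when-no (α ℕ.+ s ℕ.≟ M)
      (λ α+s≡M → s≢M∸α (trans (sym (ℕP.m+n∸m≡n α s)) (cong (_∸ α) α+s≡M)))))
    (when-yes (α ℕ.+ (M ∸ α) ℕ.≟ M) (ℕP.m+[n∸m]≡n α≤M))
    where
    M∸α<S : M ∸ α < S
    M∸α<S = ℕP.+-cancelˡ-< α (M ∸ α) S (subst (_< α ℕ.+ S) (sym (ℕP.m+[n∸m]≡n α≤M)) M<α+S)
  ... | no α≰M | _ = sumTo-zero S (λ s _ → when-no (α ℕ.+ s ℕ.≟ M)
    (λ α+s≡M → α≰M (subst (α ≤_) α+s≡M (ℕP.m≤m+n α s))))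
  ... | yes _ | no M≮α+S = sumTo-zero S (λ s s<S → when-no (α ℕ.+ s ℕ.≟ M)
    (λ α+s≡M → M≮α+S (subst (_< α ℕ.+ S) α+s≡M (ℕP.+-monoʳ-< α s<S))))

module DivisionWindow where

  open import Data.Nat
  open import Data.Nat.Properties
  open import Data.Nat.Divisibility using (_∣_; divides)
  open import Data.Empty using (⊥-elim)
  open import Data.Product using (_×_; _,_)
  open import Relation.Binary.PropositionalEquality
  import Data.Nat.Tactic.RingSolver as ℕ-Solver

  module _ {n r N d : ℕ} (n≡r+N*d : n ≡ r + N * d) (r<d : r < d) where

    n<[1+N]*d : n < suc N * d
    n<[1+N]*d = subst (_< suc N * d) (sym n≡r+N*d) (+-monoˡ-< (N * d) r<d)

    [1+N]*d≤n+d : suc N * d ≤ n + d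
    [1+N]*d≤n+d = begin
      suc N * d       ≡⟨ +-comm d (N * d) ⟩
      N * d + d       ≤⟨ m≤n+m (N * d + d) r ⟩
      r + (N * d + d) ≡⟨ +-assoc r (N * d) d ⟨
      r + N * d + d   ≡⟨ cong (_+ d) n≡r+N*d ⟨
      n + d           ∎
      where open ≤-Reasoning

    window-unique : ∀ {m} → n < m * d → m * d ≤ n + d → m ≡ suc N
    window-unique {m} n<m*d m*d≤n+d = ≤-antisym m≤1+N 1+N≤m
      where
      1+N≤m : suc N ≤ m
      1+N≤m = *-cancelʳ-< d N m (≤-<-trans (m≤n+m (N * d) r) (subst (_< m * d) n≡r+N*d n<m*d))
      m≤1+N : m ≤ suc N
      m≤1+N = ≤-pred (*-cancelʳ-< d m (2 + N) (≤-<-trans m*d≤n+d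
        (subst (_< (2 + N) * d) (sym (cong (_+ d) n≡r+N*d))
          (subst (r + N * d + d <_) (regroup d N) (+-monoˡ-< d (+-monoˡ-< (N * d) r<d))))))
        where
        regroup : ∀ d N → d + N * d + d ≡ (2 + N) * d
        regroup = ℕ-Solver.solve-∀

  N≤m<3+N : ∀ {x N m d} .{{_ : NonZero d}} → x < d + d + d → x + N * d ≡ m * d → N ≤ m × m < 3 + N
  N≤m<3+N {x} {N} {m} {d} x<3d x+Nd≡md =
      *-cancelʳ-≤ N m d (subst (N * d ≤_) x+Nd≡md (m≤n+m (N * d) x))
    , *-cancelʳ-< d m (3 + N) (subst₂ _<_ x+Nd≡md (regroup N d) (+-monoˡ-< (N * d) x<3d))
    where
    regroup : ∀ N d → d + d + d + N * d ≡ (3 + N) * d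
    regroup = ℕ-Solver.solve-∀

  d∣m∧0<m<d+d⇒m≡d : ∀ {d m} → d ∣ m → 0 < m → m < d + d → m ≡ d
  d∣m∧0<m<d+d⇒m≡d {d} (divides 1 refl) _ _ = +-identityʳ d
  d∣m∧0<m<d+d⇒m≡d {d} (divides (suc (suc c)) refl) _ m<d+d =
    ⊥-elim (<⇒≱ m<d+d (+-monoʳ-≤ d (m≤m+n d (c * d))))

module Comparisons where

  import Data.Nat as ℕ
  open import Data.Integer as ℤ using (+_; +<+; +≤+)
  import Data.Integer.Properties as ℤP
  open import Data.Integer.Tactic.RingSolver using (solve-∀)
  open import Defs using (toQ)
  open import Data.Rational.Unnormalised as ℚ using (ℚᵘ)
  import Data.Rational.Unnormalised.Properties as ℚP
  open import Data.Product using (_×_; _,_)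
  open import Data.Sum using (inj₁; inj₂)
  open import Function using (_⇔_; mk⇔; case_of_)
  open import Relation.Binary.PropositionalEquality

  private
    cancel : ∀ a c → a ℤ.+ c ℤ.+ ℤ.- c ≡ a
    cancel = solve-∀

  shift-< : ∀ {a b c x y} → a ℤ.+ c ≡ + x → b ℤ.+ c ≡ + y → (a ℤ.< b ⇔ x ℕ.< y)
  shift-< {a} {b} {c} a+c≡x b+c≡y = mk⇔
    (λ a<b → ℤP.drop‿+<+ (subst₂ ℤ._<_ a+c≡x b+c≡y (ℤP.+-monoˡ-< c a<b)))
    (λ x<y → subst₂ ℤ._<_ (cancel a c) (cancel b c)
      (ℤP.+-monoˡ-< (ℤ.- c) (subst₂ ℤ._<_ (sym a+c≡x) (sym b+c≡y) (+<+ x<y))))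

  shift-≤ : ∀ {a b c x y} → a ℤ.+ c ≡ + x → b ℤ.+ c ≡ + y → (a ℤ.≤ b ⇔ x ℕ.≤ y)
  shift-≤ {a} {b} {c} a+c≡x b+c≡y = mk⇔
    (λ a≤b → ℤP.drop‿+≤+ (subst₂ ℤ._≤_ a+c≡x b+c≡y (ℤP.+-monoˡ-≤ c a≤b)))
    (λ x≤y → subst₂ ℤ._≤_ (cancel a c) (cancel b c)
      (ℤP.+-monoˡ-≤ (ℤ.- c) (subst₂ ℤ._≤_ (sym a+c≡x) (sym b+c≡y) (+≤+ x≤y))))

  ⊔-<-⇔ : ∀ {p q r : ℚᵘ} → (p ℚ.⊔ q ℚ.< r ⇔ (p ℚ.< r × q ℚ.< r))
  ⊔-<-⇔ {p} {q} = mk⇔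
    (λ p⊔q<r → ℚP.≤-<-trans (ℚP.p≤p⊔q p q) p⊔q<r , ℚP.≤-<-trans (ℚP.p≤q⊔p p q) p⊔q<r)
    (λ where
      (p<r , q<r) → case ℚP.⊔-sel p q of λ where
        (inj₁ p⊔q≃p) → ℚP.<-respˡ-≃ (ℚP.≃-sym p⊔q≃p) p<r
        (inj₂ p⊔q≃q) → ℚP.<-respˡ-≃ (ℚP.≃-sym p⊔q≃q) q<r)

  ≤-⊓-⇔ : ∀ {p q r : ℚᵘ} → (r ℚ.≤ p ℚ.⊓ q ⇔ (r ℚ.≤ p × r ℚ.≤ q))
  ≤-⊓-⇔ {p} {q} = mk⇔ (λ r≤p⊓q → ℚP.p≤q⊓r⇒p≤q p q r≤p⊓q , ℚP.p≤q⊓r⇒p≤r p q r≤p⊓q)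
                        (λ (r≤p , r≤q) → ℚP.⊓-glb r≤p r≤q)

  toQ-<⇔ : ∀ {a b} → (toQ (+ a) ℚ.< toQ (+ b)) ⇔ (a ℕ.< b)
  toQ-<⇔ {a} {b} = mk⇔
    (λ a<b → ℤP.drop‿+<+ (subst₂ ℤ._<_ (ℤP.*-identityʳ (+ a)) (ℤP.*-identityʳ (+ b)) (ℚP.drop-*<* a<b)))
    (λ a<b → ℚ.*<* (subst₂ ℤ._<_ (sym (ℤP.*-identityʳ (+ a))) (sym (ℤP.*-identityʳ (+ b))) (+<+ a<b)))

  toQ-≤⇔ : ∀ {a b} → (toQ (+ a) ℚ.≤ toQ (+ b)) ⇔ (a ℕ.≤ b)
  toQ-≤⇔ {a} {b} = mk⇔
    (λ a≤b → ℤP.drop‿+≤+ (subst₂ ℤ._≤_ (ℤP.*-identityʳ (+ a)) (ℤP.*-identityʳ (+ b)) (ℚP.drop-*≤* a≤b)))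
    (λ a≤b → ℚ.*≤* (subst₂ ℤ._≤_ (sym (ℤP.*-identityʳ (+ a))) (sym (ℤP.*-identityʳ (+ b))) (+≤+ a≤b)))

module Parity where

  open import Data.Nat
  open import Data.Nat.Properties
  open import Data.Nat.Divisibility using (_∣_; ∣⇒≤; m%n≡0⇒n∣m)
  open import Data.Nat.DivMod using (_/_; _%_; m%n<n; m≡m%n+[m/n]*n)
  open import Data.Nat.Primality
    using (Prime; euclidsLemma; prime[2]; prime⇒irreducible; prime⇒nonZero; prime⇒nonTrivial)
  open import Data.Integer as ℤ using (+_; 1ℤ; -1ℤ)
  import Data.Integer.Properties as ℤP
  open import Data.Empty using (⊥-elim)
  open import Data.Sum using (inj₁; inj₂)
  open import Function using (_∘_)
  open import Relation.Nullary using (¬_)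
  open import Relation.Binary.PropositionalEquality

  private
    variable
      p : ℕ

  2∤p^e : Prime p → p ≢ 2 → ∀ e → ¬ 2 ∣ p ^ e
  2∤p^e pr p≢2 zero    2∣1 = <-irrefl refl (∣⇒≤ 2∣1)
  2∤p^e {p} pr p≢2 (suc e) 2∣p^[1+e] with euclidsLemma p (p ^ e) prime[2] 2∣p^[1+e]
  ... | inj₂ 2∣p^e = 2∤p^e pr p≢2 e 2∣p^e
  ... | inj₁ 2∣p with prime⇒irreducible pr 2∣p
  ...   | inj₁ ()
  ...   | inj₂ 2≡p = p≢2 (sym 2≡p)

  odd⇒≡1+[/2]*2 : ∀ {m} → ¬ 2 ∣ m → m ≡ suc ((m / 2) * 2)
  odd⇒≡1+[/2]*2 {m} 2∤m = trans (m≡m%n+[m/n]*n m 2) (cong (_+ (m / 2) * 2) m%2≡1)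
    where
    m%2≡1 : m % 2 ≡ 1
    m%2≡1 with m % 2 in m%2≡ | m%n<n m 2
    ... | 0           | _            = ⊥-elim (2∤m (m%n≡0⇒n∣m m 2 m%2≡))
    ... | 1           | _            = refl
    ... | suc (suc _) | s≤s (s≤s ())

  3≤p^e : Prime p → p ≢ 2 → ∀ {e} → 1 ≤ e → 3 ≤ p ^ e
  3≤p^e {p} pr p≢2 {e} 1≤e = ≤-trans 3≤p (subst (_≤ p ^ e) (*-identityʳ p) (^-monoʳ-≤ p 1≤e))
    where
    instance _ = prime⇒nonZero pr
    3≤p : 3 ≤ p
    3≤p = ≤∧≢⇒< (nonTrivial⇒n>1 p {{prime⇒nonTrivial pr}}) (p≢2 ∘ sym)

  -1^j≡1 : ∀ {j} z → + j ≡ z ℤ.+ z → -1ℤ ℤ.^ j ≡ 1ℤ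
  -1^j≡1 {j} (+ m) j≡m+m = begin
    -1ℤ ℤ.^ j          ≡⟨ cong (-1ℤ ℤ.^_) (ℤP.+-injective j≡m+m) ⟩
    -1ℤ ℤ.^ (m + m)    ≡⟨ cong (λ k → -1ℤ ℤ.^ (m + k)) (+-identityʳ m) ⟨
    -1ℤ ℤ.^ (2 * m)    ≡⟨ ℤP.^-*-assoc -1ℤ 2 m ⟨
    (-1ℤ ℤ.^ 2) ℤ.^ m  ≡⟨ ℤP.^-zeroˡ m ⟩
    1ℤ                 ∎
    where open ≡-Reasoning

module Evaluation where

  open FiniteSums
  open Indicators
  open DivisionWindow
  open Comparisons
  open Parity using (-1^j≡1)
  open Reduction using (termII′; II′)
  open import Defs
  open import Data.Nat as ℕ using (ℕ; zero; suc; _≤_; _<_; _∸_; s≤s; z≤n)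
  import Data.Nat.Properties as ℕP
  import Data.Nat.Divisibility as ℕ
  open import Data.Empty using (⊥-elim)
  open import Data.Nat.DivMod using (_/_; _%_; m%n<n; m≡m%n+[m/n]*n)
  open import Data.Nat.Combinatorics using (_C_; k>n⇒nCk≡0)
  open import Data.Integer as ℤ using (ℤ; +_; -[1+_]; 0ℤ; 1ℤ; -1ℤ)
  import Data.Integer.Properties as ℤP
  import Data.Rational.Unnormalised.Properties as ℚP
  open import Data.Integer.Divisibility.Signed using (_∣_; divides; ∣-refl; ∣⇒∣ᵤ; ∣m+n∣n⇒∣m; ∣n⇒∣m*n)
  open import Data.Integer.Tactic.RingSolver using (solve-∀)
  import Data.Nat.Tactic.RingSolver as ℕ-Solver
  open import Data.Rational.Unnormalised as ℚ using (mkℚᵘ; 1ℚᵘ)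
  open import Function using (_⇔_; mk⇔; Equivalence)
  open Equivalence using (to; from)
  open import Data.Product using (_×_; _,_; proj₁; proj₂)
  open import Relation.Nullary using (Dec; yes; no; ¬_)
  open import Relation.Nullary.Decidable using (_×-dec_)
  open import Relation.Binary.PropositionalEquality

  -- q is written q′ + 2, so that q ∸ 1 and q ∸ 2 in the definitions of II and X reduce.
  module _ (q′ h : ℕ) (Q≡2h : suc q′ ≡ 2 ℕ.* h) (u v : ℕ) where

    Q q n N r : ℕ
    Q = suc q′
    q = suc Q
    n = u ℕ.+ v ℕ.* q
    N = n / Q
    r = n % Q

    r<Q : r < Q
    r<Q = m%n<n n Q

    n≡r+N*Q : n ≡ r ℕ.+ N ℕ.* Q
    n≡r+N*Q = m≡m%n+[m/n]*n n Q

    +n≡r+N*Q : + n ≡ + r ℤ.+ + N ℤ.* + Q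
    +n≡r+N*Q = trans (cong +_ n≡r+N*Q) (cong (λ x → + r ℤ.+ x) (ℤP.pos-* N Q))

    private
      pos-∸ : ∀ {a b} → b ≤ a → + (a ∸ b) ≡ + a ℤ.- + b
      pos-∸ {a} {b} b≤a = sym (trans (ℤP.m-n≡m⊖n a b) (ℤP.⊖-≥ b≤a))

      solve-for : ∀ {a} b {c} → a ℤ.+ b ≡ c → a ≡ c ℤ.- b
      solve-for {a} b refl = sym (cancel a b)
        where
        cancel : ∀ a b → (a ℤ.+ b) ℤ.- b ≡ a
        cancel = solve-∀

      solve-for-subtrahend : ∀ a {b c} → a ℤ.- b ≡ c → b ≡ a ℤ.- c
      solve-for-subtrahend a {b} refl = sym (cancel a b)
        where
        cancel : ∀ a b → a ℤ.- (a ℤ.- b) ≡ b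
        cancel = solve-∀

    k₀ : ℕ
    k₀ = Q ∸ r

    j₀ : ℕ → ℤ
    j₀ α = (+ α ℤ.+ 1ℤ ℤ.- + N) ℤ.* + Q ℤ.- (+ r ℤ.+ + r)

    k₀+r≡Q : k₀ ℕ.+ r ≡ Q
    k₀+r≡Q = ℕP.m∸n+n≡m (ℕP.<⇒≤ r<Q)

    αQ+k₀-n≡j₀ : ∀ α → (+ α ℤ.* + Q ℤ.+ + k₀) ℤ.- + n ≡ j₀ α
    αQ+k₀-n≡j₀ α = begin
      (+ α ℤ.* + Q ℤ.+ + k₀) ℤ.- + n
        ≡⟨ cong₂ (λ a b → (+ α ℤ.* + Q ℤ.+ a) ℤ.- b) (pos-∸ (ℕP.<⇒≤ r<Q)) +n≡r+N*Q ⟩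
      (+ α ℤ.* + Q ℤ.+ (+ Q ℤ.- + r)) ℤ.- (+ r ℤ.+ + N ℤ.* + Q)
        ≡⟨ expand (+ α) (+ Q) (+ r) (+ N) ⟩
      j₀ α ∎
      where
      open ≡-Reasoning
      expand : ∀ α Q r N →
        (α ℤ.* Q ℤ.+ (Q ℤ.- r)) ℤ.- (r ℤ.+ N ℤ.* Q) ≡ (α ℤ.+ 1ℤ ℤ.- N) ℤ.* Q ℤ.- (r ℤ.+ r)
      expand = solve-∀

    -1^j₀≡1 : ∀ α {j} → + j ≡ j₀ α → -1ℤ ℤ.^ j ≡ 1ℤ
    -1^j₀≡1 α +j≡j₀ = -1^j≡1 half (trans +j≡j₀ (begin
      (+ α ℤ.+ 1ℤ ℤ.- + N) ℤ.* + Q ℤ.- (+ r ℤ.+ + r)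
        ≡⟨ cong (λ x → (+ α ℤ.+ 1ℤ ℤ.- + N) ℤ.* x ℤ.- (+ r ℤ.+ + r))
             (trans (cong +_ Q≡2h) (ℤP.pos-* 2 h)) ⟩
      (+ α ℤ.+ 1ℤ ℤ.- + N) ℤ.* (+ 2 ℤ.* + h) ℤ.- (+ r ℤ.+ + r)
        ≡⟨ halve (+ α ℤ.+ 1ℤ ℤ.- + N) (+ h) (+ r) ⟩
      half ℤ.+ half ∎))
      where
      open ≡-Reasoning
      half = (+ α ℤ.+ 1ℤ ℤ.- + N) ℤ.* + h ℤ.- + r
      halve : ∀ a h r → a ℤ.* (+ 2 ℤ.* h) ℤ.- (r ℤ.+ r) ≡ (a ℤ.* h ℤ.- r) ℤ.+ (a ℤ.* h ℤ.- r)
      halve = solve-∀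

    equation-at-β₀ : ∀ {α} k j → α ≤ Q →
      ((+ (q ℕ.* Q) ℤ.+ + k) ℤ.- + j) ℤ.- + (α ℕ.+ (Q ∸ α) ℕ.* q) ≡ (+ α ℤ.* + Q ℤ.+ + k) ℤ.- + j
    equation-at-β₀ {α} k j α≤Q = begin
      ((+ (q ℕ.* Q) ℤ.+ + k) ℤ.- + j) ℤ.- + (α ℕ.+ (Q ∸ α) ℕ.* q)
        ≡⟨ cong₂ (λ a b → ((a ℤ.+ + k) ℤ.- + j) ℤ.- (+ α ℤ.+ b)) (ℤP.pos-* q Q)
             (trans (ℤP.pos-* (Q ∸ α) q) (cong (ℤ._* + q) (pos-∸ α≤Q))) ⟩
      (((1ℤ ℤ.+ + Q) ℤ.* + Q ℤ.+ + k) ℤ.- + j) ℤ.- (+ α ℤ.+ (+ Q ℤ.- + α) ℤ.* (1ℤ ℤ.+ + Q))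
        ≡⟨ expand (+ Q) (+ k) (+ j) (+ α) ⟩
      (+ α ℤ.* + Q ℤ.+ + k) ℤ.- + j ∎
      where
      open ≡-Reasoning
      expand : ∀ Q k j α → (((1ℤ ℤ.+ Q) ℤ.* Q ℤ.+ k) ℤ.- j) ℤ.- (α ℤ.+ (Q ℤ.- α) ℤ.* (1ℤ ℤ.+ Q))
                           ≡ (α ℤ.* Q ℤ.+ k) ℤ.- j
      expand = solve-∀

    divisor-at-β₀ : ∀ α {k j} → + j ≡ (+ α ℤ.* + Q ℤ.+ + k) ℤ.- + n →
      (+ (2 ℕ.* k) ℤ.- + j) ℤ.- + Q ≡ + (k ℕ.+ r) ℤ.+ (+ N ℤ.- + α ℤ.- 1ℤ) ℤ.* + Q
    divisor-at-β₀ α {k} {j} +j≡ = begin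
      (+ (2 ℕ.* k) ℤ.- + j) ℤ.- + Q
        ≡⟨ cong₂ (λ a b → (a ℤ.- b) ℤ.- + Q) (ℤP.pos-* 2 k)
             (trans +j≡ (cong (λ m → (+ α ℤ.* + Q ℤ.+ + k) ℤ.- m) +n≡r+N*Q)) ⟩
      (+ 2 ℤ.* + k ℤ.- ((+ α ℤ.* + Q ℤ.+ + k) ℤ.- (+ r ℤ.+ + N ℤ.* + Q))) ℤ.- + Q
        ≡⟨ expand (+ k) (+ α) (+ Q) (+ r) (+ N) ⟩
      + (k ℕ.+ r) ℤ.+ (+ N ℤ.- + α ℤ.- 1ℤ) ℤ.* + Q ∎
      where
      open ≡-Reasoning
      expand : ∀ k α Q r N → (+ 2 ℤ.* k ℤ.- ((α ℤ.* Q ℤ.+ k) ℤ.- (r ℤ.+ N ℤ.* Q))) ℤ.- Q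
                             ≡ (k ℤ.+ r) ℤ.+ (N ℤ.- α ℤ.- 1ℤ) ℤ.* Q
      expand = solve-∀

    condII-at-β₀⇒ : ∀ {α k j} → α ≤ Q → condII q n α (Q ∸ α) k j → k ≡ k₀ × + j ≡ j₀ α
    condII-at-β₀⇒ {α} {k} {j} α≤Q (_ , _ , _ , 1≤k , k+j≤Q , Q∣D , eqn) =
      k≡k₀ , trans +j≡ (trans (cong (λ k → (+ α ℤ.* + Q ℤ.+ + k) ℤ.- + n) k≡k₀) (αQ+k₀-n≡j₀ α))
      where
      +j≡ : + j ≡ (+ α ℤ.* + Q ℤ.+ + k) ℤ.- + n
      +j≡ = solve-for-subtrahend (+ α ℤ.* + Q ℤ.+ + k) (trans (sym (equation-at-β₀ k j α≤Q)) eqn)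
      Q∣k+r : Q ℕ.∣ k ℕ.+ r
      Q∣k+r = ∣⇒∣ᵤ (∣m+n∣n⇒∣m {m = + (k ℕ.+ r)}
        (subst (+ Q ∣_) (divisor-at-β₀ α +j≡)
          (subst (λ c → + Q ∣ (+ (2 ℕ.* k) ℤ.- + j) ℤ.- + c) (ℕP.m+[n∸m]≡n α≤Q) Q∣D))
        (∣n⇒∣m*n (+ N ℤ.- + α ℤ.- 1ℤ) ∣-refl))
      k+r≡Q : k ℕ.+ r ≡ Q
      k+r≡Q = d∣m∧0<m<d+d⇒m≡d Q∣k+r (ℕP.<-≤-trans 1≤k (ℕP.m≤m+n k r))
                (ℕP.+-mono-≤-< (ℕP.≤-trans (ℕP.m≤m+n k j) k+j≤Q) r<Q)
      k≡k₀ : k ≡ k₀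
      k≡k₀ = trans (sym (ℕP.m+n∸n≡m k r)) (cong (_∸ r) k+r≡Q)

    condII-at-β₀⇐ : ∀ {α j} → 1 ≤ α → α ≤ Q → + j ≡ j₀ α → j ≤ r → condII q n α (Q ∸ α) k₀ j
    condII-at-β₀⇐ {α@(suc α′)} {j} _ α≤Q +j≡j₀ j≤r =
      ℕP.m∸n≤m q′ α′ , subst (1 ≤_) (sym α+β≡Q) (s≤s z≤n) , ℕP.≤-reflexive α+β≡Q ,
      ℕP.m<n⇒0<n∸m r<Q , subst (k₀ ℕ.+ j ≤_) k₀+r≡Q (ℕP.+-monoʳ-≤ k₀ j≤r) ,
      subst (λ c → + Q ∣ (+ (2 ℕ.* k₀) ℤ.- + j) ℤ.- + c) (sym α+β≡Q) (divides (+ N ℤ.- + α) D≡) ,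
      trans (equation-at-β₀ k₀ j α≤Q)
        (trans (cong (λ x → (+ α ℤ.* + Q ℤ.+ + k₀) ℤ.- x) +j≡) (cancel (+ α ℤ.* + Q ℤ.+ + k₀) (+ n)))
      where
      α+β≡Q : α ℕ.+ (Q ∸ α) ≡ Q
      α+β≡Q = ℕP.m+[n∸m]≡n α≤Q
      +j≡ : + j ≡ (+ α ℤ.* + Q ℤ.+ + k₀) ℤ.- + n
      +j≡ = trans +j≡j₀ (sym (αQ+k₀-n≡j₀ α))
      cancel : ∀ a n → a ℤ.- (a ℤ.- n) ≡ n
      cancel = solve-∀
      collect : ∀ Q N α → Q ℤ.+ (N ℤ.- α ℤ.- 1ℤ) ℤ.* Q ≡ (N ℤ.- α) ℤ.* Q
      collect = solve-∀
      D≡ : (+ (2 ℕ.* k₀) ℤ.- + j) ℤ.- + Q ≡ (+ N ℤ.- + α) ℤ.* + Q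
      D≡ = trans (divisor-at-β₀ α +j≡)
        (trans (cong (λ x → + x ℤ.+ (+ N ℤ.- + α ℤ.- 1ℤ) ℤ.* + Q) k₀+r≡Q) (collect (+ Q) (+ N) (+ α)))

    slice : ℕ → ℤ
    slice α = when ((1 ℕ.≤? α) ×-dec (α ℕ.≤? Q)) (binomZ (+ r) (j₀ α))

    sliceII′ : ℕ → ℤ
    sliceII′ α =
      sumTo Q λ β → sumTo q λ k → sumTo q λ j → when (condII? q n α β k j) (termII′ q α β k j)

    private
      off-β : ∀ α β → α ℕ.+ β ≢ Q →
        (sumTo q λ k → sumTo q λ j → when (condII? q n α β k j) (termII′ q α β k j)) ≡ 0ℤ
      off-β α β α+β≢Q = sumTo-zero q λ k _ → sumTo-zero q λ j _ →
        trans (cong (when (condII? q n α β k j)) (when-no (α ℕ.+ β ℕ.≟ Q) α+β≢Q)) (when-0ℤ _)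

    term-at-β₀-k₀ : ∀ {α} → 1 ≤ α → α ≤ Q → ∀ j →
      when (condII? q n α (Q ∸ α) k₀ j) (termII′ q α (Q ∸ α) k₀ j) ≡ when (+ j ℤ.≟ j₀ α) (+ (r C j))
    term-at-β₀-k₀ {α} 1≤α α≤Q j with condII? q n α (Q ∸ α) k₀ j | + j ℤ.≟ j₀ α
    ... | yes c | yes +j≡j₀ = begin
      termII′ q α (Q ∸ α) k₀ j
        ≡⟨ when-yes (α ℕ.+ (Q ∸ α) ℕ.≟ Q) (ℕP.m+[n∸m]≡n α≤Q) ⟩
      + ((Q ∸ k₀) C j) ℤ.* (-1ℤ ℤ.^ j)
        ≡⟨ cong₂ (λ m s → + (m C j) ℤ.* s) (ℕP.m∸[m∸n]≡n (ℕP.<⇒≤ r<Q)) (-1^j₀≡1 α +j≡j₀) ⟩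
      + (r C j) ℤ.* 1ℤ
        ≡⟨ ℤP.*-identityʳ (+ (r C j)) ⟩
      + (r C j) ∎
      where open ≡-Reasoning
    ... | yes c | no +j≢j₀ = ⊥-elim (+j≢j₀ (proj₂ (condII-at-β₀⇒ α≤Q c)))
    ... | no ¬c | no _ = refl
    ... | no ¬c | yes +j≡j₀ with j ℕ.≤? r
    ...   | yes j≤r = ⊥-elim (¬c (condII-at-β₀⇐ 1≤α α≤Q +j≡j₀ j≤r))
    ...   | no j≰r = cong +_ (sym (k>n⇒nCk≡0 (ℕP.≰⇒> j≰r)))

    sliceII′≡slice : ∀ α → α < q → sliceII′ α ≡ slice α
    sliceII′≡slice zero _ = sumTo-zero Q (λ β β<Q → off-β zero β (λ β≡Q → ℕP.<-irrefl β≡Q β<Q))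
    sliceII′≡slice α@(suc _) α<q = begin
      sliceII′ α
        ≡⟨ sumTo-single Q β₀ β₀<Q (λ β _ β≢β₀ → off-β α β (λ α+β≡Q → β≢β₀
             (trans (sym (ℕP.m+n∸m≡n α β)) (cong (_∸ α) α+β≡Q)))) ⟩
      (sumTo q λ k → sumTo q λ j → when (condII? q n α β₀ k j) (termII′ q α β₀ k j))
        ≡⟨ sumTo-single q k₀ (s≤s (ℕP.m∸n≤m Q r)) (λ k _ k≢k₀ → sumTo-zero q λ j _ →
             when-no (condII? q n α β₀ k j) (λ c → k≢k₀ (proj₁ (condII-at-β₀⇒ α≤Q c)))) ⟩
      (sumTo q λ j → when (condII? q n α β₀ k₀ j) (termII′ q α β₀ k₀ j))
        ≡⟨ sumTo-cong q (λ j _ → term-at-β₀-k₀ (s≤s z≤n) α≤Q j) ⟩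
      (sumTo q λ j → when (+ j ℤ.≟ j₀ α) (+ (r C j)))
        ≡⟨ Σ-when≡binomZ r q (j₀ α) (ℕP.m<n⇒m<1+n r<Q) ⟩
      binomZ (+ r) (j₀ α)
        ≡⟨ when-yes ((1 ℕ.≤? α) ×-dec (α ℕ.≤? Q)) (s≤s z≤n , α≤Q) ⟨
      slice α ∎
      where
      open ≡-Reasoning
      α≤Q : α ≤ Q
      α≤Q = ℕP.≤-pred α<q
      β₀ : ℕ
      β₀ = Q ∸ α
      β₀<Q : β₀ < Q
      β₀<Q = ℕP.∸-monoʳ-< {Q} {α} {0} (s≤s z≤n) α≤Q

    numX : ℕ → ℤ
    numX s = (+ v ℤ.- + s) ℤ.* + Q ℤ.+ + (u ℕ.+ v)

    private
      X≡numX/Q : ∀ s → X q u v s ≡ mkℚᵘ (numX s) q′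
      X≡numX/Q s = cong₂ mkℚᵘ (cong (λ x → (+ v ℤ.- + s) ℤ.* + Q ℤ.+ x) (ℤP.*-identityʳ (+ (u ℕ.+ v))))
                             (ℕP.+-identityʳ q′)

      X+1≡[numX+Q]/Q : ∀ s → X q u v s ℚ.+ 1ℚᵘ ≡ mkℚᵘ (numX s ℤ.+ + Q) q′
      X+1≡[numX+Q]/Q s = trans (cong (ℚ._+ 1ℚᵘ) (X≡numX/Q s))
        (cong₂ mkℚᵘ (cong₂ ℤ._+_ (ℤP.*-identityʳ (numX s)) (ℤP.*-identityˡ (+ Q))) (ℕP.*-identityʳ q′))

      numX+sQ≡n : ∀ s → numX s ℤ.+ + s ℤ.* + Q ≡ + n
      numX+sQ≡n s = begin
        (+ v ℤ.- + s) ℤ.* + Q ℤ.+ (+ u ℤ.+ + v) ℤ.+ + s ℤ.* + Q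
          ≡⟨ expand (+ u) (+ v) (+ s) (+ Q) ⟩
        + u ℤ.+ + v ℤ.* (1ℤ ℤ.+ + Q)
          ≡⟨ cong (λ x → + u ℤ.+ x) (ℤP.pos-* v q) ⟨
        + n ∎
        where
        open ≡-Reasoning
        expand : ∀ u v s Q → (v ℤ.- s) ℤ.* Q ℤ.+ (u ℤ.+ v) ℤ.+ s ℤ.* Q ≡ u ℤ.+ v ℤ.* (1ℤ ℤ.+ Q)
        expand = solve-∀

      +[α+s]Q : ∀ α s → + α ℤ.* + Q ℤ.+ + s ℤ.* + Q ≡ + ((α ℕ.+ s) ℕ.* Q)
      +[α+s]Q α s = sym (trans (ℤP.pos-* (α ℕ.+ s) Q) (ℤP.*-distribʳ-+ (+ Q) (+ α) (+ s)))

    X<α⇔ : ∀ s α → (X q u v s ℚ.< toQ (+ α)) ⇔ (n < (α ℕ.+ s) ℕ.* Q)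
    X<α⇔ s α = mk⇔
      (λ X<α → to shift (ℚP.drop-*<* (subst (ℚ._< toQ (+ α)) (X≡numX/Q s) X<α)))
      (λ n<[α+s]Q → subst (ℚ._< toQ (+ α)) (sym (X≡numX/Q s)) (ℚ.*<* (from shift n<[α+s]Q)))
      where
      shift = shift-< (trans (cong (ℤ._+ + s ℤ.* + Q) (ℤP.*-identityʳ (numX s))) (numX+sQ≡n s))
                      (+[α+s]Q α s)

    α≤X+1⇔ : ∀ s α → (toQ (+ α) ℚ.≤ X q u v s ℚ.+ 1ℚᵘ) ⇔ ((α ℕ.+ s) ℕ.* Q ≤ n ℕ.+ Q)
    α≤X+1⇔ s α = mk⇔
      (λ α≤X+1 → to shift (ℚP.drop-*≤* (subst (toQ (+ α) ℚ.≤_) (X+1≡[numX+Q]/Q s) α≤X+1)))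
      (λ ≤n+Q → subst (toQ (+ α) ℚ.≤_) (sym (X+1≡[numX+Q]/Q s)) (ℚ.*≤* (from shift ≤n+Q)))
      where
      rearrange : ∀ a Q c → (a ℤ.+ Q) ℤ.* 1ℤ ℤ.+ c ≡ (a ℤ.+ c) ℤ.+ Q
      rearrange = solve-∀
      shift = shift-≤ (+[α+s]Q α s)
        (trans (rearrange (numX s) (+ Q) (+ s ℤ.* + Q))
          (cong (ℤ._+ + Q) (numX+sQ≡n s)))

    condR⇔ : ∀ s α → condR q u v s α ⇔ (1 ≤ α × α ≤ Q × α ℕ.+ s ≡ suc N)
    condR⇔ s α = mk⇔
      (λ (lower , upper) →
        let 0<α , X<α   = to ⊔-<-⇔ lower
            α≤Q , α≤X+1 = to ≤-⊓-⇔ upper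
        in  to toQ-<⇔ 0<α , to toQ-≤⇔ α≤Q ,
            window-unique {N = N} n≡r+N*Q r<Q (to (X<α⇔ s α) X<α) (to (α≤X+1⇔ s α) α≤X+1))
      (λ (1≤α , α≤Q , α+s≡1+N) →
          from ⊔-<-⇔ (from toQ-<⇔ 1≤α , from (X<α⇔ s α)
            (subst (λ m → n < m ℕ.* Q) (sym α+s≡1+N) (n<[1+N]*d {N = N} n≡r+N*Q r<Q)))
        , from ≤-⊓-⇔ (from toQ-≤⇔ α≤Q , from (α≤X+1⇔ s α)
            (subst (λ m → m ℕ.* Q ≤ n ℕ.+ Q) (sym α+s≡1+N) ([1+N]*d≤n+d {N = N} n≡r+N*Q r<Q))))

    private
      +[u+v]≡ : + (u ℕ.+ v) ≡ (+ r ℤ.+ + N ℤ.* + Q) ℤ.- + v ℤ.* + Q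
      +[u+v]≡ = solve-for (+ v ℤ.* + Q) (begin
        + (u ℕ.+ v) ℤ.+ + v ℤ.* + Q ≡⟨ cong (λ x → + (u ℕ.+ v) ℤ.+ x) (ℤP.pos-* v Q) ⟨
        + (u ℕ.+ v ℕ.+ v ℕ.* Q)     ≡⟨ cong +_ (regroup u v Q) ⟩
        + n                         ≡⟨ +n≡r+N*Q ⟩
        + r ℤ.+ + N ℤ.* + Q         ∎)
        where
        open ≡-Reasoning
        regroup : ∀ u v Q → u ℕ.+ v ℕ.+ v ℕ.* Q ≡ u ℕ.+ v ℕ.* suc Q
        regroup = ℕ-Solver.solve-∀

      +s≡ : ∀ {α s} → α ℕ.+ s ≡ suc N → + s ≡ (+ N ℤ.+ 1ℤ) ℤ.- + α
      +s≡ {α} {s} α+s≡1+N = solve-for (+ α) (begin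
        + (s ℕ.+ α)   ≡⟨ cong +_ (trans (ℕP.+-comm s α) (trans α+s≡1+N (ℕP.+-comm 1 N))) ⟩
        + (N ℕ.+ 1)   ∎)
        where open ≡-Reasoning

    termR≡binomZ-j₀ : ∀ {s α} → α ℕ.+ s ≡ suc N → termR q u v s α ≡ binomZ (+ r) (j₀ α)
    termR≡binomZ-j₀ {s} {α} α+s≡1+N = cong₂ binomZ top≡r bottom≡j₀
      where
      open ≡-Reasoning
      +s≡1+N-α = +s≡ α+s≡1+N
      top≡r : + (u ℕ.+ v) ℤ.- (((+ s ℤ.+ + α) ℤ.- + v) ℤ.- 1ℤ) ℤ.* + Q ≡ + r
      top≡r = begin
        + (u ℕ.+ v) ℤ.- (((+ s ℤ.+ + α) ℤ.- + v) ℤ.- 1ℤ) ℤ.* + Q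
          ≡⟨ cong₂ (λ a b → a ℤ.- (((b ℤ.+ + α) ℤ.- + v) ℤ.- 1ℤ) ℤ.* + Q) +[u+v]≡ +s≡1+N-α ⟩
        ((+ r ℤ.+ + N ℤ.* + Q) ℤ.- + v ℤ.* + Q)
          ℤ.- (((((+ N ℤ.+ 1ℤ) ℤ.- + α) ℤ.+ + α) ℤ.- + v) ℤ.- 1ℤ) ℤ.* + Q
          ≡⟨ simplify (+ r) (+ N) (+ Q) (+ v) (+ α) ⟩
        + r ∎
        where
        simplify : ∀ r N Q v α →
          ((r ℤ.+ N ℤ.* Q) ℤ.- v ℤ.* Q) ℤ.- (((((N ℤ.+ 1ℤ) ℤ.- α) ℤ.+ α) ℤ.- v) ℤ.- 1ℤ) ℤ.* Q ≡ r
        simplify = solve-∀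
      bottom≡j₀ : (((+ s ℤ.+ + (2 ℕ.* α)) ℤ.- + (2 ℕ.* v)) ℤ.* + Q) ℤ.- + (2 ℕ.* (u ℕ.+ v)) ≡ j₀ α
      bottom≡j₀ = begin
        (((+ s ℤ.+ + (2 ℕ.* α)) ℤ.- + (2 ℕ.* v)) ℤ.* + Q) ℤ.- + (2 ℕ.* (u ℕ.+ v))
          ≡⟨ cong₂ (λ a b → (((+ s ℤ.+ a) ℤ.- b) ℤ.* + Q) ℤ.- + (2 ℕ.* (u ℕ.+ v)))
               (ℤP.pos-* 2 α) (ℤP.pos-* 2 v) ⟩
        (((+ s ℤ.+ + 2 ℤ.* + α) ℤ.- + 2 ℤ.* + v) ℤ.* + Q) ℤ.- + (2 ℕ.* (u ℕ.+ v))
          ≡⟨ cong₂ (λ a b → (((a ℤ.+ + 2 ℤ.* + α) ℤ.- + 2 ℤ.* + v) ℤ.* + Q) ℤ.- b) +s≡1+N-α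
               (trans (ℤP.pos-* 2 (u ℕ.+ v)) (cong (λ x → + 2 ℤ.* x) +[u+v]≡)) ⟩
        (((((+ N ℤ.+ 1ℤ) ℤ.- + α) ℤ.+ + 2 ℤ.* + α) ℤ.- + 2 ℤ.* + v) ℤ.* + Q)
          ℤ.- + 2 ℤ.* ((+ r ℤ.+ + N ℤ.* + Q) ℤ.- + v ℤ.* + Q)
          ≡⟨ simplify (+ r) (+ N) (+ Q) (+ v) (+ α) ⟩
        j₀ α ∎
        where
        simplify : ∀ r N Q v α →
          (((((N ℤ.+ 1ℤ) ℤ.- α) ℤ.+ + 2 ℤ.* α) ℤ.- + 2 ℤ.* v) ℤ.* Q)
            ℤ.- + 2 ℤ.* ((r ℤ.+ N ℤ.* Q) ℤ.- v ℤ.* Q)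
            ≡ (α ℤ.+ 1ℤ ℤ.- N) ℤ.* Q ℤ.- (r ℤ.+ r)
        simplify = solve-∀

    binomZ-j₀≡0 : ∀ {α} → ¬ (α ≤ suc N × suc N < α ℕ.+ 3) → binomZ (+ r) (j₀ α) ≡ 0ℤ
    binomZ-j₀≡0 {α} outside = at (j₀ α) refl
      where
      at : ∀ z → j₀ α ≡ z → binomZ (+ r) z ≡ 0ℤ
      at -[1+ _ ] _ = refl
      at (+ J) j₀≡J with J ℕ.≤? r
      ... | no J≰r = cong +_ (k>n⇒nCk≡0 (ℕP.≰⇒> J≰r))
      ... | yes J≤r = ⊥-elim (outside (ℕP.≤-pred (ℕP.≤-pred [1+α]<3+N) ,
                                         subst (suc N <_) (ℕP.+-comm 3 α) (s≤s (s≤s N≤1+α))))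
        where
        x+NQ≡[1+α]Q : J ℕ.+ r ℕ.+ r ℕ.+ N ℕ.* Q ≡ suc α ℕ.* Q
        x+NQ≡[1+α]Q = ℤP.+-injective (begin
          + J ℤ.+ + r ℤ.+ + r ℤ.+ + (N ℕ.* Q)  ≡⟨ cong (λ x → x ℤ.+ + r ℤ.+ + r ℤ.+ + (N ℕ.* Q)) j₀≡J ⟨
          j₀ α ℤ.+ + r ℤ.+ + r ℤ.+ + (N ℕ.* Q) ≡⟨ cong (λ x → j₀ α ℤ.+ + r ℤ.+ + r ℤ.+ x) (ℤP.pos-* N Q) ⟩
          j₀ α ℤ.+ + r ℤ.+ + r ℤ.+ + N ℤ.* + Q ≡⟨ simplify (+ α) (+ N) (+ Q) (+ r) ⟩
          (1ℤ ℤ.+ + α) ℤ.* + Q                ≡⟨ ℤP.pos-* (suc α) Q ⟨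
          + (suc α ℕ.* Q)                     ∎)
          where
          open ≡-Reasoning
          simplify : ∀ α N Q r →
            (α ℤ.+ 1ℤ ℤ.- N) ℤ.* Q ℤ.- (r ℤ.+ r) ℤ.+ r ℤ.+ r ℤ.+ N ℤ.* Q ≡ (1ℤ ℤ.+ α) ℤ.* Q
          simplify = solve-∀
        x<3Q : J ℕ.+ r ℕ.+ r < Q ℕ.+ Q ℕ.+ Q
        x<3Q = ℕP.≤-<-trans (ℕP.+-monoˡ-≤ r (ℕP.+-monoˡ-≤ r J≤r))
                 (ℕP.+-mono-< (ℕP.+-mono-< r<Q r<Q) r<Q)
        N≤1+α = proj₁ (N≤m<3+N x<3Q x+NQ≡[1+α]Q)
        [1+α]<3+N = proj₂ (N≤m<3+N x<3Q x+NQ≡[1+α]Q)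

    sliceRHS : ℕ → ℤ
    sliceRHS α = sumTo 3 λ s → when (condR? q u v s α) (termR q u v s α)

    sliceRHS≡slice : ∀ α → sliceRHS α ≡ slice α
    sliceRHS≡slice α with (1 ℕ.≤? α) ×-dec (α ℕ.≤? Q)
    ... | no ¬range = sumTo-zero 3 λ s _ → when-no (condR? q u v s α) {termR q u v s α}
            λ c → let 1≤α , α≤Q , _ = to (condR⇔ s α) c in ¬range (1≤α , α≤Q)
    ... | yes (1≤α , α≤Q) = begin
      sliceRHS α
        ≡⟨ sumTo-cong 3 (λ s _ → when-cong (condR? q u v s α) (α ℕ.+ s ℕ.≟ suc N)
             {termR q u v s α} {binomZ (+ r) (j₀ α)}
             (mk⇔ (λ c → proj₂ (proj₂ (to (condR⇔ s α) c)))
                  (λ α+s≡1+N → from (condR⇔ s α) (1≤α , α≤Q , α+s≡1+N)))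
             (λ c → termR≡binomZ-j₀ (proj₂ (proj₂ (to (condR⇔ s α) c))))) ⟩
      sumTo 3 (λ s → when (α ℕ.+ s ℕ.≟ suc N) (binomZ (+ r) (j₀ α)))
        ≡⟨ Σ-when-shift 3 α (suc N) (binomZ (+ r) (j₀ α)) ⟩
      when ((α ℕ.≤? suc N) ×-dec (suc N ℕ.<? α ℕ.+ 3)) (binomZ (+ r) (j₀ α))
        ≡⟨ window ((α ℕ.≤? suc N) ×-dec (suc N ℕ.<? α ℕ.+ 3)) ⟩
      binomZ (+ r) (j₀ α) ∎
      where
      open ≡-Reasoning
      window : (d : Dec (α ≤ suc N × suc N < α ℕ.+ 3)) → when d (binomZ (+ r) (j₀ α)) ≡ binomZ (+ r) (j₀ α)
      window (yes _)       = refl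
      window (no outside) = sym (binomZ-j₀≡0 outside)

    II′≡RHS : II′ q n ≡ RHS q u v
    II′≡RHS = begin
      II′ q n          ≡⟨ sumTo-cong q sliceII′≡slice ⟩
      sumTo q slice    ≡⟨ sumTo-cong q (λ α _ → sliceRHS≡slice α) ⟨
      sumTo q sliceRHS ≡⟨ sumTo-comm 3 q (λ s α → when (condR? q u v s α) (termR q u v s α)) ⟨
      RHS q u v        ∎
      where open ≡-Reasoning

open import Defs
open import Data.Nat using (ℕ; _+_; _*_; _∸_; _^_; _≤_; _<_)
open import Data.Nat.Primality using (Prime)
open import Data.Integer using (+_; _-_)
open import Data.Integer.Divisibility.Signed using (_∣_)
open import Relation.Binary.PropositionalEquality using (_≡_; _≢_)

open import Data.Nat using (suc; s≤s; _/_)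
open import Data.Nat.Properties using (suc-injective; *-comm)
open import Relation.Binary.PropositionalEquality using (refl; sym; trans; subst)
open Parity using (3≤p^e; 2∤p^e; odd⇒≡1+[/2]*2)
open Reduction using (p∣II-II′)
open Evaluation using (II′≡RHS)

lemma4p2 : (p e : ℕ) → Prime p → p ≢ 2 → 1 ≤ e →
    (n u v : ℕ) → 1 ≤ n → n ≤ (p ^ e) * (p ^ e) ∸ 1 →
    u < p ^ e → v < p ^ e → n ≡ u + v * (p ^ e) →
    (+ p) ∣ (II (p ^ e) n - RHS (p ^ e) u v)
lemma4p2 p e pr p≢2 1≤e n u v _ _ _ _ refl
  with p ^ e in p^e≡q | 3≤p^e pr p≢2 1≤e | odd⇒≡1+[/2]*2 (2∤p^e pr p≢2 e)
... | suc (suc q′) | s≤s (s≤s _) | q≡1+h*2 =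
  subst (λ t → + p ∣ II q n′ - t) (II′≡RHS q′ h Q≡2h u v) (p∣II-II′ pr p≢2 e (sym p^e≡q) n′)
  where
  q = suc (suc q′)
  n′ = u + v * q
  h = q / 2
  Q≡2h : suc q′ ≡ 2 * h
  Q≡2h = trans (suc-injective q≡1+h*2) (*-comm h 2)
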